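{- Let $\Phi\subseteq Fm$ be a maximal theory of L (a maximally L-consistent set of formulas), and define $\varphi\approx_\Phi\psi$ iff $\Phi\vdash_L\varphi\equiv\psi$. Then $\approx_\Phi$ is an equivalence relation on $Fm$ with the following properties: (1) if $\varphi_1\approx_\Phi\psi_1$ and $\varphi_2\approx_\Phi\psi_2$, then $\square\varphi_1\approx_\Phi\square\psi_1$ and $(\varphi_1*\varphi_2)\approx_\Phi(\psi_1*\psi_2)$ for each $*\in\{\vee,\wedge,\rightarrow\}$; (2) if $\varphi\approx_\Phi\psi$, then $\varphi\in\Phi\iff\psi\in\Phi$; (3) if $\varphi\approx_\Phi\psi$, then $\square\varphi\in\Phi\iff\square\psi\in\Phi$.
   Context: Let $V=\{x_0,x_1,\dots\}$ be an infinite set of propositional variables; $Fm$ is generated from $V$ by $\bot$, binary $\rightarrow,\vee,\wedge$ and unary $\square$. Abbreviations: $\neg\varphi:=\varphi\rightarrow\bot$, $\varphi\equiv\psi:=\square(\varphi\rightarrow\psi)\wedge\square(\psi\rightarrow\varphi)$; $\chi[x:=\varphi]$ is substitution of $\varphi$ for $x$ in $\chi$. The logic L: axioms are all formulas of the forms (i) substitution instances (variables replaced by arbitrary formulas of $Fm$) of intuitionistic propositional tautologies; (ii) $\square\varphi\rightarrow\varphi$; (iii) $\square(\varphi\rightarrow\psi)\rightarrow(\square(\psi\rightarrow\chi)\rightarrow\square(\varphi\rightarrow\chi))$; (iv) $\square(\varphi\vee\psi)\rightarrow(\square\varphi\vee\square\psi)$; rules are Modus Ponens and Axiom Necessitation (from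 an axiom $\varphi$ of form (i)–(iv) infer $\square\varphi$); additionally all formulas $\varphi\vee\neg\varphi$ and $(\varphi\equiv\psi)\rightarrow(\chi[x:=\varphi]\equiv\chi[x:=\psi])$ are theorems (usable in derivations, not subject to Axiom Necessitation). $\Phi\vdash_L\varphi$: $\varphi$ is derivable from $\Phi$ in L. A set is L-consistent if it does not derive $\bot$; a maximal theory is a consistent set not properly contained in any consistent set. -}

module Defs where

open import Data.Nat using (ℕ; _≟_)
open import Data.Product using (Σ; ∃; _×_; _,_)
open import Relation.Binary.PropositionalEquality using (_≡_)
open import Relation.Nullary using (¬_; yes; no)
open import Data.Empty using (⊥)

infixr 5 _⇒_
infixr 6 _∨′_
infixr 7 _∧′_
data Fm : Set where
  var  : ℕ → Fm
  ⊥′   : Fm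
  _⇒_  : Fm → Fm → Fm
  _∨′_ : Fm → Fm → Fm
  _∧′_ : Fm → Fm → Fm
  □_   : Fm → Fm

¬′_ : Fm → Fm
¬′ φ = φ ⇒ ⊥′

_≡′_ : Fm → Fm → Fm
φ ≡′ ψ = (□ (φ ⇒ ψ)) ∧′ (□ (ψ ⇒ φ))

_[_≔_] : Fm → ℕ → Fm → Fm
var y [ x ≔ φ ] with y ≟ x
... | yes _ = φ
... | no _  = var y
⊥′ [ x ≔ φ ] = ⊥′
(a ⇒ b) [ x ≔ φ ] = (a [ x ≔ φ ]) ⇒ (b [ x ≔ φ ])
(a ∨′ b) [ x ≔ φ ] = (a [ x ≔ φ ]) ∨′ (b [ x ≔ φ ])
(a ∧′ b) [ x ≔ φ ] = (a [ x ≔ φ ]) ∧′ (b [ x ≔ φ ])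
(□ a) [ x ≔ φ ] = □ (a [ x ≔ φ ])

-- Propositional (non-modal) formulas, for intuitionistic tautologies
data PFm : Set where
  pvar : ℕ → PFm
  p⊥   : PFm
  _p⇒_ : PFm → PFm → PFm
  _p∨_ : PFm → PFm → PFm
  _p∧_ : PFm → PFm → PFm

-- Intuitionistic propositional calculus (standard Hilbert system);
-- its theorems are exactly the intuitionistic tautologies.
data IPC : PFm → Set where
  k    : ∀ A B → IPC (A p⇒ (B p⇒ A))
  s    : ∀ A B C → IPC ((A p⇒ (B p⇒ C)) p⇒ ((A p⇒ B) p⇒ (A p⇒ C)))
  ∧e₁  : ∀ A B → IPC ((A p∧ B) p⇒ A)
  ∧e₂  : ∀ A B → IPC ((A p∧ B) p⇒ B)
  ∧i   : ∀ A B → IPC (A p⇒ (B p⇒ (A p∧ B)))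
  ∨i₁  : ∀ A B → IPC (A p⇒ (A p∨ B))
  ∨i₂  : ∀ A B → IPC (B p⇒ (A p∨ B))
  ∨e   : ∀ A B C → IPC ((A p⇒ C) p⇒ ((B p⇒ C) p⇒ ((A p∨ B) p⇒ C)))
  efq  : ∀ A → IPC (p⊥ p⇒ A)
  mp   : ∀ {A B} → IPC (A p⇒ B) → IPC A → IPC B

inst : (ℕ → Fm) → PFm → Fm
inst σ (pvar n) = σ n
inst σ p⊥ = ⊥′
inst σ (A p⇒ B) = inst σ A ⇒ inst σ B
inst σ (A p∨ B) = inst σ A ∨′ inst σ B
inst σ (A p∧ B) = inst σ A ∧′ inst σ B

data Axiom : Fm → Set where
  ipc  : ∀ (A : PFm) (σ : ℕ → Fm) → IPC A → Axiom (inst σ A)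
  refl□ : ∀ φ → Axiom ((□ φ) ⇒ φ)
  trans□ : ∀ φ ψ χ → Axiom ((□ (φ ⇒ ψ)) ⇒ ((□ (ψ ⇒ χ)) ⇒ (□ (φ ⇒ χ))))
  disj□ : ∀ φ ψ → Axiom ((□ (φ ∨′ ψ)) ⇒ ((□ φ) ∨′ (□ ψ)))

FmSet : Set₁
FmSet = Fm → Set

data _⊢_ (Φ : FmSet) : Fm → Set where
  hyp  : ∀ {φ} → Φ φ → Φ ⊢ φ
  ax   : ∀ {φ} → Axiom φ → Φ ⊢ φ
  nec  : ∀ {φ} → Axiom φ → Φ ⊢ (□ φ)
  lem  : ∀ φ → Φ ⊢ (φ ∨′ (¬′ φ))
  sp   : ∀ φ ψ χ x → Φ ⊢ ((φ ≡′ ψ) ⇒ ((χ [ x ≔ φ ]) ≡′ (χ [ x ≔ ψ ])))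
  mp   : ∀ {φ ψ} → Φ ⊢ (φ ⇒ ψ) → Φ ⊢ φ → Φ ⊢ ψ

Consistent : FmSet → Set
Consistent Φ = ¬ (Φ ⊢ ⊥′)

_⊆_ : FmSet → FmSet → Set
Φ ⊆ Ψ = ∀ φ → Φ φ → Ψ φ

MaximalTheory : FmSet → Set₁
MaximalTheory Φ = Consistent Φ × (∀ (Ψ : FmSet) → Φ ⊆ Ψ → Consistent Ψ → Ψ ⊆ Φ)

_≈[_]_ : Fm → FmSet → Fm → Set
φ ≈[ Φ ] ψ = Φ ⊢ (φ ≡′ ψ)

module Submission where

-- Write ⊢ for derivability from a fixed Φ.
--  * ≡′ is reflexive because ⊢ □(φ → φ) by Axiom Necessitation of the
--    intuitionistic tautology φ → φ; symmetric by swapping the conjuncts; and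
--    transitive by axiom (iii) applied to each conjunct.
--  * Congruence comes from the replacement theorem
--    (φ ≡ ψ) → (χ[x:=φ] ≡ χ[x:=ψ]):  if a context χ with hole x computes
--    f d under every substitution x := d, then f respects ≡′.  For □ the
--    context is □x; for a binary connective ∗ we replace one argument at a
--    time, in the contexts x ∗ c with x chosen fresh for c, then use
--    transitivity.
--  * By axiom (ii), ⊢ φ ≡′ ψ and ⊢ φ give ⊢ ψ.  A maximal theory is
--    deductively closed, so ≡′-equivalent formulas are simultaneously in Φ
--    or not; (3) is (2) applied to □φ ≈ □ψ, which holds by congruence.

open import Defs
open import Data.Product using (_×_; _,_)
open import Data.Sum using (_⊎_; inj₁; inj₂)
open import Data.Nat using (ℕ; zero; suc; _≤_; _⊔_; _≟_)
open import Data.Nat.Properties using (m≤m⊔n; m≤n⊔m; ≤-trans; <⇒≢; ≤-refl)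
open import Data.Empty using (⊥-elim)
open import Function.Bundles using (_⇔_; mk⇔)
open import Relation.Binary.Structures using (IsEquivalence)
open import Relation.Binary.PropositionalEquality
  using (_≡_; refl; cong; cong₂; subst₂)
open import Relation.Nullary using (yes; no)

varBound : Fm → ℕ
varBound (var n)  = suc n
varBound ⊥′       = zero
varBound (a ⇒ b)  = varBound a ⊔ varBound b
varBound (a ∨′ b) = varBound a ⊔ varBound b
varBound (a ∧′ b) = varBound a ⊔ varBound b
varBound (□ a)    = varBound a

subst-fresh : ∀ χ x φ → varBound χ ≤ x → χ [ x ≔ φ ] ≡ χ
subst-fresh (var y) x φ y<x with y ≟ x
... | yes y≡x = ⊥-elim (<⇒≢ y<x y≡x)
... | no _    = refl
subst-fresh ⊥′       x φ _  = refl
subst-fresh (a ⇒ b)  x φ le =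
  cong₂ _⇒_ (subst-fresh a x φ (≤-trans (m≤m⊔n _ _) le)) (subst-fresh b x φ (≤-trans (m≤n⊔m _ _) le))
subst-fresh (a ∨′ b) x φ le =
  cong₂ _∨′_ (subst-fresh a x φ (≤-trans (m≤m⊔n _ _) le)) (subst-fresh b x φ (≤-trans (m≤n⊔m _ _) le))
subst-fresh (a ∧′ b) x φ le =
  cong₂ _∧′_ (subst-fresh a x φ (≤-trans (m≤m⊔n _ _) le)) (subst-fresh b x φ (≤-trans (m≤n⊔m _ _) le))
subst-fresh (□ a)    x φ le = cong □_ (subst-fresh a x φ le)

subst-var : ∀ x φ → var x [ x ≔ φ ] ≡ φ
subst-var x φ with x ≟ x
... | yes _  = refl
... | no x≢x = ⊥-elim (x≢x refl)

SubstHomomorphic : (Fm → Fm → Fm) → Set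
SubstHomomorphic _∗_ = ∀ x d a c → (a ∗ c) [ x ≔ d ] ≡ (a [ x ≔ d ]) ∗ (c [ x ≔ d ])

-- Intuitionistic theorem A → A, via S K K.
ipc-id : ∀ A → IPC (A p⇒ A)
ipc-id A = mp (mp (s A (A p⇒ A) A) (k A (A p⇒ A))) (k A A)

pair : Fm → Fm → ℕ → Fm
pair a b zero    = a
pair a b (suc _) = b

module Derived {Φ : FmSet} where

  tautology : ∀ {A} → IPC A → ∀ a b → Φ ⊢ inst (pair a b) A
  tautology t a b = ax (ipc _ (pair a b) t)

  ∧-intro : ∀ {a b} → Φ ⊢ a → Φ ⊢ b → Φ ⊢ (a ∧′ b)
  ∧-intro {a} {b} p q = mp (mp (tautology (∧i (pvar 0) (pvar 1)) a b) p) q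

  ∧-elim₁ : ∀ {a b} → Φ ⊢ (a ∧′ b) → Φ ⊢ a
  ∧-elim₁ {a} {b} p = mp (tautology (∧e₁ (pvar 0) (pvar 1)) a b) p

  ∧-elim₂ : ∀ {a b} → Φ ⊢ (a ∧′ b) → Φ ⊢ b
  ∧-elim₂ {a} {b} p = mp (tautology (∧e₂ (pvar 0) (pvar 1)) a b) p

  ≡′-refl : ∀ a → Φ ⊢ (a ≡′ a)
  ≡′-refl a = ∧-intro □a⇒a □a⇒a
    where
    □a⇒a : Φ ⊢ (□ (a ⇒ a))
    □a⇒a = nec (ipc _ (pair a a) (ipc-id (pvar 0)))

  ≡′-sym : ∀ {a b} → Φ ⊢ (a ≡′ b) → Φ ⊢ (b ≡′ a)
  ≡′-sym p = ∧-intro (∧-elim₂ p) (∧-elim₁ p)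

  ≡′-trans : ∀ {a b c} → Φ ⊢ (a ≡′ b) → Φ ⊢ (b ≡′ c) → Φ ⊢ (a ≡′ c)
  ≡′-trans {a} {b} {c} p q =
    ∧-intro (mp (mp (ax (trans□ a b c)) (∧-elim₁ p)) (∧-elim₁ q))
            (mp (mp (ax (trans□ c b a)) (∧-elim₂ q)) (∧-elim₂ p))

  replacement : ∀ {f : Fm → Fm} χ x → (∀ d → χ [ x ≔ d ] ≡ f d) →
                ∀ {a b} → Φ ⊢ (a ≡′ b) → Φ ⊢ (f a ≡′ f b)
  replacement χ x computes {a} {b} p =
    subst₂ (λ u v → Φ ⊢ (u ≡′ v)) (computes a) (computes b) (mp (sp a b χ x) p)

  ≡′-cong-□ : ∀ {a b} → Φ ⊢ (a ≡′ b) → Φ ⊢ ((□ a) ≡′ (□ b))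
  ≡′-cong-□ = replacement (□ var 0) 0 (λ d → cong □_ (subst-var 0 d))

  -- A substitution-homomorphic connective respects ≡′ in both arguments;
  -- each argument is replaced in a context whose hole is fresh for the other.
  ≡′-cong₂ : ∀ {_∗_} → SubstHomomorphic _∗_ →
             ∀ {a b c d} → Φ ⊢ (a ≡′ b) → Φ ⊢ (c ≡′ d) → Φ ⊢ ((a ∗ c) ≡′ (b ∗ d))
  ≡′-cong₂ {_∗_} hom {a} {b} {c} {d} p q =
    ≡′-trans (replacement (var x ∗ c) x left p) (replacement (b ∗ var y) y right q)
    where
    x = varBound c
    y = varBound b
    left : ∀ e → (var x ∗ c) [ x ≔ e ] ≡ e ∗ c
    left e rewrite hom x e (var x) c = cong₂ _∗_ (subst-var x e) (subst-fresh c x e ≤-refl)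
    right : ∀ e → (b ∗ var y) [ y ≔ e ] ≡ b ∗ e
    right e rewrite hom y e b (var y) = cong₂ _∗_ (subst-fresh b y e ≤-refl) (subst-var y e)

  ≡′-transport : ∀ {a b} → Φ ⊢ (a ≡′ b) → Φ ⊢ a → Φ ⊢ b
  ≡′-transport {a} {b} p q = mp (mp (ax (refl□ (a ⇒ b))) (∧-elim₁ p)) q

open Derived

cut : ∀ {Ψ Φ χ} → Ψ ⊢ χ → (∀ ψ → Ψ ψ → Φ ⊢ ψ) → Φ ⊢ χ
cut (hyp h)      Φ⊢Ψ = Φ⊢Ψ _ h
cut (ax a)       _   = ax a
cut (nec a)      _   = nec a
cut (lem φ)      _   = lem φ
cut (sp φ ψ χ x) _   = sp φ ψ χ x
cut (mp p q)     Φ⊢Ψ = mp (cut p Φ⊢Ψ) (cut q Φ⊢Ψ)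

-- A maximal theory is deductively closed: Φ ∪ {φ} is consistent whenever
-- Φ ⊢ φ, so by maximality it is contained in Φ.
maximal-closed : ∀ {Φ} → MaximalTheory Φ → ∀ {φ} → Φ ⊢ φ → Φ φ
maximal-closed {Φ} (consistent , maximal) {φ} Φ⊢φ =
  maximal Φ+φ (λ _ → inj₁) (λ ⊥-proof → consistent (cut ⊥-proof Φ⊢Φ+φ)) φ (inj₂ refl)
  where
  Φ+φ : FmSet
  Φ+φ χ = Φ χ ⊎ χ ≡ φ
  Φ⊢Φ+φ : ∀ ψ → Φ+φ ψ → Φ ⊢ ψ
  Φ⊢Φ+φ _ (inj₁ h)    = hyp h
  Φ⊢Φ+φ _ (inj₂ refl) = Φ⊢φ

maximal-respects-≡′ : ∀ {Φ} → MaximalTheory Φ → ∀ φ ψ → φ ≈[ Φ ] ψ → Φ φ ⇔ Φ ψ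
maximal-respects-≡′ M φ ψ p = mk⇔
  (λ φ∈Φ → maximal-closed M (≡′-transport p (hyp φ∈Φ)))
  (λ ψ∈Φ → maximal-closed M (≡′-transport (≡′-sym p) (hyp ψ∈Φ)))

lemma4p1 : (Φ : FmSet) → MaximalTheory Φ →
    IsEquivalence (λ φ ψ → φ ≈[ Φ ] ψ)
    × (∀ φ₁ ψ₁ φ₂ ψ₂ → φ₁ ≈[ Φ ] ψ₁ → φ₂ ≈[ Φ ] ψ₂ →
         ((□ φ₁) ≈[ Φ ] (□ ψ₁))
         × ((φ₁ ∨′ φ₂) ≈[ Φ ] (ψ₁ ∨′ ψ₂))
         × ((φ₁ ∧′ φ₂) ≈[ Φ ] (ψ₁ ∧′ ψ₂))
         × ((φ₁ ⇒ φ₂) ≈[ Φ ] (ψ₁ ⇒ ψ₂)))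
    × (∀ φ ψ → φ ≈[ Φ ] ψ → Φ φ ⇔ Φ ψ)
    × (∀ φ ψ → φ ≈[ Φ ] ψ → Φ (□ φ) ⇔ Φ (□ ψ))
lemma4p1 Φ M =
  record { refl = ≡′-refl _ ; sym = ≡′-sym ; trans = ≡′-trans }
  , (λ _ _ _ _ p q →
        ≡′-cong-□ p
      , ≡′-cong₂ (λ _ _ _ _ → refl) p q
      , ≡′-cong₂ (λ _ _ _ _ → refl) p q
      , ≡′-cong₂ (λ _ _ _ _ → refl) p q)
  , maximal-respects-≡′ M
  , (λ φ ψ p → maximal-respects-≡′ M (□ φ) (□ ψ) (≡′-cong-□ p))
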